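{- Let $n\geq 2$ be an integer. If $A$ is a non-empty subset of $U(n)$, then $D_{A,\mathbb Z_n'}(n)=D_A(n)+1$. If $A\subseteq\mathbb Z_n'$ is non-empty and $A\not\subseteq U(n)$, then $D_{A,\mathbb Z_n'}(n)=D_A(n)$.
   Context: $\mathbb Z_n=\mathbb Z/n\mathbb Z$ as a module over itself, $\mathbb Z_n'=\mathbb Z_n\setminus\{0\}$, and $U(n)$ is the group of units of $\mathbb Z_n$. A subsequence is a non-empty subfamily of terms in the original order. A sequence $(x_1,\ldots,x_k)$ is an $A$-weighted zero-sum sequence if there exist $a_i\in A$ with $\sum a_ix_i=0$, and an $(A,B)$-weighted zero-sum sequence if there exist $a_i\in A$, $b_i\in B$ with $\sum a_ix_i=0$ and $\sum b_ia_i=0$. $D_{A,B}(n)$ (resp. $D_A(n)$) is the least positive $k$ such that every sequence of length $k$ in $\mathbb Z_n$ has an $(A,B)$-weighted (resp. $A$-weighted) zero-sum subsequence. -}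

module Defs where

open import Data.Nat as ℕ using (ℕ; zero; suc; NonZero; _≤_; _+_)
open import Data.Nat.DivMod using (_%_; m%n<n)
open import Data.Fin using (Fin; toℕ; fromℕ<)
import Data.Fin as Fin
open import Data.Fin.Subset using (Subset; _∈_; Nonempty)
open import Data.Product using (Σ; ∃; _×_; _,_)
open import Relation.Binary.PropositionalEquality using (_≡_; _≢_)
open import Relation.Unary using (Pred)
open import Level using (0ℓ)

-- Z_n is represented by Fin n (residues 0..n-1) with arithmetic mod n.
module _ (n : ℕ) .{{_ : NonZero n}} where

  [_]ₙ : ℕ → Fin n
  [ m ]ₙ = fromℕ< (m%n<n m n)

  0ₙ : Fin n
  0ₙ = [ 0 ]ₙ

  1ₙ : Fin n
  1ₙ = [ 1 ]ₙ

  _+ₙ_ : Fin n → Fin n → Fin n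
  a +ₙ b = [ toℕ a + toℕ b ]ₙ

  _*ₙ_ : Fin n → Fin n → Fin n
  a *ₙ b = [ toℕ a ℕ.* toℕ b ]ₙ

  sumₙ : ∀ {k} → (Fin k → Fin n) → Fin n
  sumₙ {zero}  f = 0ₙ
  sumₙ {suc k} f = f Fin.zero +ₙ sumₙ (λ i → f (Fin.suc i))

  sumOver : ∀ {k} → Subset k → (Fin k → Fin n) → Fin n
  sumOver S f = sumₙ (λ i → restrict i)
    where
    open import Data.Vec using (lookup)
    open import Data.Bool using (if_then_else_)
    restrict : _ → Fin n
    restrict i = if lookup S i then f i else 0ₙ

  IsUnit : Fin n → Set
  IsUnit a = ∃ λ b → (a *ₙ b) ≡ 1ₙ

  NonZeroₙ : Fin n → Set
  NonZeroₙ a = a ≢ 0ₙ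

  Seq : ℕ → Set
  Seq k = Fin k → Fin n

  AWeightedZS : (A : Pred (Fin n) 0ℓ) → ∀ {k} → Seq k → Subset k → Set
  AWeightedZS A x S =
    Σ (Fin _ → Fin n) λ a → (∀ i → i ∈ S → A (a i))
      × sumOver S (λ i → a i *ₙ x i) ≡ 0ₙ

  ABWeightedZS : (A B : Pred (Fin n) 0ℓ) → ∀ {k} → Seq k → Subset k → Set
  ABWeightedZS A B x S =
    Σ (Fin _ → Fin n) λ a → Σ (Fin _ → Fin n) λ b →
      (∀ i → i ∈ S → A (a i)) × (∀ i → i ∈ S → B (b i))
      × sumOver S (λ i → a i *ₙ x i) ≡ 0ₙ
      × sumOver S (λ i → b i *ₙ a i) ≡ 0ₙ

  EveryHas : (∀ {k} → Seq k → Subset k → Set) → ℕ → Set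
  EveryHas P k = (x : Seq k) → Σ (Subset k) λ S → Nonempty S × P x S

  IsLeastPos : (ℕ → Set) → ℕ → Set
  IsLeastPos Q d = 1 ≤ d × Q d × (∀ k → 1 ≤ k → Q k → d ≤ k)

  IsD_A : Pred (Fin n) 0ℓ → ℕ → Set
  IsD_A A = IsLeastPos (EveryHas (AWeightedZS A))

  IsD_AB : Pred (Fin n) 0ℓ → Pred (Fin n) 0ℓ → ℕ → Set
  IsD_AB A B = IsLeastPos (EveryHas (ABWeightedZS A B))

module Submission where

open import Defs
open import Algebra.Bundles using (CommutativeRing)
open import Algebra.Structures using (IsCommutativeRing)
import Algebra.Properties.CommutativeSemigroup as CommutativeSemigroupProperties
import Algebra.Properties.Group as GroupProperties
import Algebra.Properties.Ring as RingProperties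
open import Data.Bool using (if_then_else_)
open import Data.Empty using (⊥-elim)
open import Data.Fin as Fin using (Fin; zero; suc; toℕ; punchIn; punchOut)
open import Data.Fin.Properties
  using (toℕ-fromℕ<; toℕ-injective; toℕ<n; _≟_; any?; all?; pigeonhole; punchOut-injective; punchIn-punchOut; <⇒≢)
open import Data.Fin.Subset using (Subset; _∈_; Nonempty; inside; outside; ⊥; ⁅_⁆)
open import Data.Fin.Subset.Properties using (_∈?_; nonempty?; anySubset?; Empty-unique; x∈⁅x⁆)
open import Data.Nat as ℕ using (ℕ; NonZero; >-nonZero⁻¹; _≤_; _<_; z≤n; s≤s)
import Data.Nat.Properties as ℕ
open import Data.Nat.DivMod using (_%_; m%n<n; m<n⇒m%n≡m; n%n≡0; %-distribˡ-+; %-distribˡ-*)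
open import Data.Nat.Induction using (<-rec)
open import Data.Product using (Σ; ∃; ∃₂; _×_; _,_; proj₁)
open import Data.Sum using (_⊎_; inj₁; inj₂)
open import Data.Vec using ([]; _∷_; insertAt)
open import Data.Vec.Base using (here; there)
import Data.Vec.Functional as Vector
open import Data.Vec.Functional.Properties using (insertAt-lookup; insertAt-punchIn)
open import Function using (_∘_)
open import Level using (0ℓ)
open import Relation.Binary.Definitions using (_Respects_)
open import Relation.Binary.PropositionalEquality
  using (_≡_; _≢_; _≗_; refl; sym; trans; cong; cong₂; subst; isEquivalence; module ≡-Reasoning)
open import Relation.Nullary using (¬_; Dec; yes; no)
open import Relation.Nullary.Decidable using (map′; _×-dec_; _→-dec_; ¬?; decidable-stable)
open import Relation.Unary using (Pred; Decidable)

-- D_A(n) exists: for a₀ ∈ A the n + 1 prefix sums of a₀x₁, …, a₀xₙ collide, and having an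
-- A-weighted zero-sum subsequence is decidable.  The heart of the matter is the weight sequence
-- a of an A-weighted zero sum over S with all aᵢ ≠ 0: when n ≥ 3 and |S| ≥ 2 there are bᵢ ≠ 0
-- with ∑ bᵢaᵢ = 0 (two terms cancel crosswise, a non-unit is killed by a zero divisor, and a
-- unit absorbs a non-zero total of the others, which exists because the weights 1 and 2 on one
-- term cannot both give 0).  So only singletons S = {p}, where aₚxₚ = 0, need repair.
-- If A ⊆ U(n), a singleton forces xₚ = 0, so a sequence of length D_A + 1 has a good
-- subsequence or two zero terms; two zeros (or, for n = 2, two equal terms) form a zero sum with
-- weights (a₀, a₀), which in turn has the zero sum (1, −1).  Conversely, 0 followed by a sequence
-- without A-weighted zero sums has no (A, Z′ₙ)-weighted one, as b·u = 0 forces b = 0 for a unit u.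
-- If A contains a non-unit c, a singleton is repaired by a zero divisor of aₚ or, when aₚ is a
-- unit and hence xₚ = 0, by re-weighting xₚ with c.

collision : ∀ {m} (f : Fin m → Fin m) {t} → (∀ i → f i ≢ t) → ∃₂ λ i j → i ≢ j × f i ≡ f j
collision {ℕ.suc m} f f≢t with pigeonhole (ℕ.n<1+n m) (λ i → punchOut (f≢t i ∘ sym))
... | i , j , i<j , eq = i , j , <⇒≢ i<j , punchOut-injective (f≢t i ∘ sym) (f≢t j ∘ sym) eq

module _ {m : ℕ} where

  any-function? : ∀ {k} {P : Pred (Fin k → Fin m) 0ℓ} → P Respects _≗_ → Decidable P → Dec (∃ P)
  any-function? {ℕ.zero} resp P? = map′ (empty ,_) (λ (f , Pf) → resp (λ ()) Pf) (P? empty)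
    where
    empty : Fin 0 → Fin m
    empty ()
  any-function? {ℕ.suc k} resp P? =
    map′ (λ (c , f , Pcf) → c Vector.∷ f , Pcf)
         (λ (f , Pf) → Vector.head f , Vector.tail f , resp (λ { zero → refl ; (suc _) → refl }) Pf)
         (any? λ c → any-function? (λ f≗g → resp (λ { zero → refl ; (suc i) → f≗g i })) (P? ∘ (c Vector.∷_)))

  all-function? : ∀ {k} {P : Pred (Fin k → Fin m) 0ℓ} → P Respects _≗_ → Decidable P → Dec (∀ f → P f)
  all-function? resp P? with any-function? (λ f≗g ¬Pf Pg → ¬Pf (resp (sym ∘ f≗g) Pg)) (¬? ∘ P?)
  ... | yes (f , ¬Pf) = no λ ∀P → ¬Pf (∀P f)
  ... | no  ∄¬P       = yes λ f → decidable-stable (P? f) λ ¬Pf → ∄¬P (f , ¬Pf)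

module Residues (n : ℕ) .{{_ : NonZero n}} where

  infixl 6 _+_
  infixl 7 _*_

  _+_ _*_ : Fin n → Fin n → Fin n
  _+_ = _+ₙ_ n
  _*_ = _*ₙ_ n

  [_] : ℕ → Fin n
  [_] = [_]ₙ n

  -_ : Fin n → Fin n
  - a = [ n ℕ.∸ toℕ a ]

  0# 1# : Fin n
  0# = 0ₙ n
  1# = 1ₙ n

  private
    toℕ-[] : ∀ m → toℕ [ m ] ≡ m % n
    toℕ-[] m = toℕ-fromℕ< (m%n<n m n)

    []-cong-% : ∀ {m m′} → m % n ≡ m′ % n → [ m ] ≡ [ m′ ]
    []-cong-% eq = toℕ-injective (trans (toℕ-[] _) (trans eq (sym (toℕ-[] _))))

    [toℕ] : ∀ a → [ toℕ a ] ≡ a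
    [toℕ] a = toℕ-injective (trans (toℕ-[] (toℕ a)) (m<n⇒m%n≡m (toℕ<n a)))

    []-+ : ∀ m m′ → [ m ] + [ m′ ] ≡ [ m ℕ.+ m′ ]
    []-+ m m′ = trans (cong₂ (λ u v → [ u ℕ.+ v ]) (toℕ-[] m) (toℕ-[] m′)) ([]-cong-% (sym (%-distribˡ-+ m m′ n)))

    []-* : ∀ m m′ → [ m ] * [ m′ ] ≡ [ m ℕ.* m′ ]
    []-* m m′ = trans (cong₂ (λ u v → [ u ℕ.* v ]) (toℕ-[] m) (toℕ-[] m′)) ([]-cong-% (sym (%-distribˡ-* m m′ n)))

    +-[]ˡ : ∀ m c → [ m ] + c ≡ [ m ℕ.+ toℕ c ]
    +-[]ˡ m c = trans (cong ([ m ] +_) (sym ([toℕ] c))) ([]-+ m (toℕ c))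

    +-[]ʳ : ∀ a m → a + [ m ] ≡ [ toℕ a ℕ.+ m ]
    +-[]ʳ a m = trans (cong (_+ [ m ]) (sym ([toℕ] a))) ([]-+ (toℕ a) m)

    *-[]ˡ : ∀ m c → [ m ] * c ≡ [ m ℕ.* toℕ c ]
    *-[]ˡ m c = trans (cong ([ m ] *_) (sym ([toℕ] c))) ([]-* m (toℕ c))

    *-[]ʳ : ∀ a m → a * [ m ] ≡ [ toℕ a ℕ.* m ]
    *-[]ʳ a m = trans (cong (_* [ m ]) (sym ([toℕ] a))) ([]-* (toℕ a) m)

  isCommutativeRing : IsCommutativeRing _≡_ _+_ _*_ -_ 0# 1#
  isCommutativeRing = record
    { isRing = record
      { +-isAbelianGroup = record
        { isGroup = record
          { isMonoid = record
            { isSemigroup = record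
              { isMagma = record { isEquivalence = isEquivalence ; ∙-cong = cong₂ _+_ }
              ; assoc = +-assoc }
            ; identity = +-identityˡ , λ a → trans (+-comm a _) (+-identityˡ a) }
          ; inverse = (λ a → trans (+-comm (- a) a) (+-inverseʳ a)) , +-inverseʳ
          ; ⁻¹-cong = cong -_ }
        ; comm = +-comm }
      ; *-cong = cong₂ _*_
      ; *-assoc = *-assoc
      ; *-identity = *-identityˡ , λ a → trans (*-comm a _) (*-identityˡ a)
      ; distrib = (λ a b c → trans (*-comm a _) (trans (distribʳ a b c) (cong₂ _+_ (*-comm b a) (*-comm c a))))
                , distribʳ }
    ; *-comm = *-comm }
    where
    open ≡-Reasoning
    +-comm : ∀ a b → a + b ≡ b + a
    +-comm a b = cong [_] (ℕ.+-comm (toℕ a) (toℕ b))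
    *-comm : ∀ a b → a * b ≡ b * a
    *-comm a b = cong [_] (ℕ.*-comm (toℕ a) (toℕ b))
    +-assoc : ∀ a b c → a + b + c ≡ a + (b + c)
    +-assoc a b c = begin
      [ A ℕ.+ B ] + c       ≡⟨ +-[]ˡ (A ℕ.+ B) c ⟩
      [ A ℕ.+ B ℕ.+ C ]     ≡⟨ cong [_] (ℕ.+-assoc A B C) ⟩
      [ A ℕ.+ (B ℕ.+ C) ]   ≡⟨ +-[]ʳ a (B ℕ.+ C) ⟨
      a + [ B ℕ.+ C ]       ∎
      where
      A B C : ℕ
      A = toℕ a
      B = toℕ b
      C = toℕ c
    *-assoc : ∀ a b c → a * b * c ≡ a * (b * c)
    *-assoc a b c = begin
      [ A ℕ.* B ] * c       ≡⟨ *-[]ˡ (A ℕ.* B) c ⟩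
      [ A ℕ.* B ℕ.* C ]     ≡⟨ cong [_] (ℕ.*-assoc A B C) ⟩
      [ A ℕ.* (B ℕ.* C) ]   ≡⟨ *-[]ʳ a (B ℕ.* C) ⟨
      a * [ B ℕ.* C ]       ∎
      where
      A B C : ℕ
      A = toℕ a
      B = toℕ b
      C = toℕ c
    distribʳ : ∀ c a b → (a + b) * c ≡ a * c + b * c
    distribʳ c a b = begin
      [ A ℕ.+ B ] * c               ≡⟨ *-[]ˡ (A ℕ.+ B) c ⟩
      [ (A ℕ.+ B) ℕ.* C ]           ≡⟨ cong [_] (ℕ.*-distribʳ-+ C A B) ⟩
      [ A ℕ.* C ℕ.+ B ℕ.* C ]       ≡⟨ []-+ (A ℕ.* C) (B ℕ.* C) ⟨
      [ A ℕ.* C ] + [ B ℕ.* C ]     ∎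
      where
      A B C : ℕ
      A = toℕ a
      B = toℕ b
      C = toℕ c
    +-identityˡ : ∀ a → 0# + a ≡ a
    +-identityˡ a = trans (+-[]ˡ 0 a) ([toℕ] a)
    *-identityˡ : ∀ a → 1# * a ≡ a
    *-identityˡ a = begin
      [ 1 ] * a             ≡⟨ *-[]ˡ 1 a ⟩
      [ 1 ℕ.* toℕ a ]       ≡⟨ cong [_] (ℕ.*-identityˡ (toℕ a)) ⟩
      [ toℕ a ]             ≡⟨ [toℕ] a ⟩
      a                     ∎
    +-inverseʳ : ∀ a → a + - a ≡ 0#
    +-inverseʳ a = begin
      a + [ n ℕ.∸ toℕ a ]           ≡⟨ +-[]ʳ a (n ℕ.∸ toℕ a) ⟩
      [ toℕ a ℕ.+ (n ℕ.∸ toℕ a) ]   ≡⟨ cong [_] (ℕ.m+[n∸m]≡n (ℕ.<⇒≤ (toℕ<n a))) ⟩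
      [ n ]                         ≡⟨ []-cong-% (trans (n%n≡0 n) (sym (m<n⇒m%n≡m (>-nonZero⁻¹ n)))) ⟩
      [ 0 ]                         ∎

  commutativeRing : CommutativeRing 0ℓ 0ℓ
  commutativeRing = record { isCommutativeRing = isCommutativeRing }

  infixl 6 _-_
  _-_ : Fin n → Fin n → Fin n
  a - b = a + - b

  open CommutativeRing commutativeRing public
    using (+-comm; +-assoc; +-identityˡ; +-identityʳ; -‿inverseˡ; -‿inverseʳ;
           *-comm; *-assoc; *-identityˡ; *-identityʳ; distribʳ; zeroˡ; zeroʳ)
  open GroupProperties (CommutativeRing.+-group commutativeRing) public
    using () renaming (∙-cancelˡ to +-cancelˡ; x∙y⁻¹≈ε⇒x≈y to x-y≡0⇒x≡y)
  open CommutativeSemigroupProperties (CommutativeRing.+-commutativeSemigroup commutativeRing) public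
    using () renaming (x∙yz≈y∙xz to x+[y+z]≡y+[x+z])
  open RingProperties (CommutativeRing.ring commutativeRing) public
    using (-‿distribˡ-*; [y-z]x≈yx-zx)

  -x≡0⇒x≡0 : ∀ {x} → - x ≡ 0# → x ≡ 0#
  -x≡0⇒x≡0 {x} -x≡0 = trans (sym (+-identityʳ x)) (trans (cong (x +_) (sym -x≡0)) (-‿inverseʳ x))

  [m]≢[m′] : ∀ {m m′} → m < n → m′ < n → m ≢ m′ → [ m ] ≢ [ m′ ]
  [m]≢[m′] {m} {m′} m<n m′<n m≢m′ eq = m≢m′ (begin
    m          ≡⟨ m<n⇒m%n≡m m<n ⟨
    m % n      ≡⟨ toℕ-[] m ⟨
    toℕ [ m ]  ≡⟨ cong toℕ eq ⟩
    toℕ [ m′ ] ≡⟨ toℕ-[] m′ ⟩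
    m′ % n     ≡⟨ m<n⇒m%n≡m m′<n ⟩
    m′         ∎)
    where open ≡-Reasoning

  1≢0 : 2 ≤ n → 1# ≢ 0#
  1≢0 2≤n = [m]≢[m′] 2≤n (>-nonZero⁻¹ n) λ ()

  1+1≢0 : 2 < n → 1# + 1# ≢ 0#
  1+1≢0 2<n eq = [m]≢[m′] 2<n (>-nonZero⁻¹ n) (λ ()) (trans (sym ([]-+ 1 1)) eq)

  ≢0⇒≡1 : n ≤ 2 → ∀ a → a ≢ 0# → a ≡ 1#
  ≢0⇒≡1 n≤2 a a≢0 with toℕ a | toℕ<n a | [toℕ] a
  ... | 0               | _     | [0]≡a = ⊥-elim (a≢0 (sym [0]≡a))
  ... | 1               | _     | [1]≡a = sym [1]≡a
  ... | ℕ.suc (ℕ.suc _) | 2+m<n | _     = ⊥-elim (ℕ.<⇒≱ 2+m<n (ℕ.≤-trans n≤2 (s≤s (s≤s z≤n))))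

  y+y≡0 : 2 ≤ n → n ≤ 2 → ∀ y → y + y ≡ 0#
  y+y≡0 2≤n n≤2 y with 1# + 1# ≟ 0#
  ... | no  1+1≢0 = ⊥-elim (1≢0 2≤n (+-cancelˡ 1# 1# 0# (trans (≢0⇒≡1 n≤2 _ 1+1≢0) (sym (+-identityʳ 1#)))))
  ... | yes 1+1≡0 = begin
    y + y               ≡⟨ cong₂ _+_ (*-identityˡ y) (*-identityˡ y) ⟨
    1# * y + 1# * y     ≡⟨ distribʳ y 1# 1# ⟨
    (1# + 1#) * y       ≡⟨ cong (_* y) 1+1≡0 ⟩
    0# * y              ≡⟨ zeroˡ y ⟩
    0#                  ∎
    where open ≡-Reasoning

module _ (n : ℕ) .{{_ : NonZero n}} where

  open Residues n

  -- Units and zero divisors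

  unit*y≡0⇒y≡0 : ∀ {a y} → IsUnit n a → a * y ≡ 0# → y ≡ 0#
  unit*y≡0⇒y≡0 {a} {y} (u , au≡1) ay≡0 = begin
    y             ≡⟨ *-identityˡ y ⟨
    1# * y        ≡⟨ cong (_* y) (trans (sym au≡1) (*-comm a u)) ⟩
    u * a * y     ≡⟨ *-assoc u a y ⟩
    u * (a * y)   ≡⟨ cong (u *_) ay≡0 ⟩
    u * 0#        ≡⟨ zeroʳ u ⟩
    0#            ∎
    where open ≡-Reasoning

  unit≢0 : 2 ≤ n → ∀ {a} → IsUnit n a → a ≢ 0#
  unit≢0 2≤n (u , au≡1) a≡0 = 1≢0 2≤n (trans (sym au≡1) (trans (cong (_* u) a≡0) (zeroˡ u)))

  IsUnit? : Decidable (IsUnit n)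
  IsUnit? a = any? λ b → a * b ≟ 1#

  -- Multiplication by a non-unit misses 1, so it is not injective on the finite ring.
  zero-divisor : ∀ {a} → ¬ IsUnit n a → ∃ λ c → c ≢ 0# × c * a ≡ 0#
  zero-divisor {a} ¬unit with collision (_* a) (λ c ca≡1 → ¬unit (c , trans (*-comm a c) ca≡1))
  ... | i , j , i≢j , ia≡ja = i - j , i≢j ∘ x-y≡0⇒x≡y i j , (begin
    (i - j) * a       ≡⟨ [y-z]x≈yx-zx a i j ⟩
    i * a - j * a     ≡⟨ cong (_- j * a) ia≡ja ⟩
    j * a - j * a     ≡⟨ -‿inverseʳ (j * a) ⟩
    0#                ∎)
    where open ≡-Reasoning

  ≢0∧¬unit⇒2<n : ∀ {c} → c ≢ 0# → ¬ IsUnit n c → 2 < n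
  ≢0∧¬unit⇒2<n {c} c≢0 ¬unit with n ℕ.≤? 2
  ... | yes n≤2 = ⊥-elim (¬unit (subst (IsUnit n) (sym (≢0⇒≡1 n≤2 c c≢0)) (1# , *-identityˡ 1#)))
  ... | no  n≰2 = ℕ.≰⇒> n≰2

  avoid-zero : 2 < n → ∀ v {a} → a ≢ 0# → ∃ λ b → b ≢ 0# × b * a + v ≢ 0#
  avoid-zero 2<n v {a} a≢0 with 1# * a + v ≟ 0#
  ... | no  a+v≢0 = 1# , 1≢0 (ℕ.<⇒≤ 2<n) , a+v≢0
  ... | yes a+v≡0 = 1# + 1# , 1+1≢0 2<n , λ 2a+v≡0 → a≢0 (begin
    a                       ≡⟨ *-identityˡ a ⟨
    1# * a                  ≡⟨ +-identityʳ _ ⟨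
    1# * a + 0#             ≡⟨ cong (1# * a +_) a+v≡0 ⟨
    1# * a + (1# * a + v)   ≡⟨ +-assoc _ _ v ⟨
    1# * a + 1# * a + v     ≡⟨ cong (_+ v) (distribʳ a 1# 1#) ⟨
    (1# + 1#) * a + v       ≡⟨ 2a+v≡0 ⟩
    0#                      ∎)
    where open ≡-Reasoning

  -- Sums over subsets

  infix 9 ∑[_]_
  ∑[_]_ : ∀ {k} → Subset k → (Fin k → Fin n) → Fin n
  ∑[ S ] f = sumOver n S f

  ∑-cong : ∀ {k} (S : Subset k) {f g : Fin k → Fin n} → (∀ i → i ∈ S → f i ≡ g i) → ∑[ S ] f ≡ ∑[ S ] g
  ∑-cong []            f≗g = refl
  ∑-cong (inside ∷ S)  f≗g = cong₂ _+_ (f≗g zero here) (∑-cong S λ i i∈S → f≗g (suc i) (there i∈S))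
  ∑-cong (outside ∷ S) f≗g = cong (0# +_) (∑-cong S λ i i∈S → f≗g (suc i) (there i∈S))

  ∑-⊥ : ∀ {k} (f : Fin k → Fin n) → ∑[ ⊥ ] f ≡ 0#
  ∑-⊥ {ℕ.zero}  f = refl
  ∑-⊥ {ℕ.suc k} f = trans (+-identityˡ _) (∑-⊥ (f ∘ suc))

  ∑-⁅⁆ : ∀ {k} (p : Fin k) (f : Fin k → Fin n) → ∑[ ⁅ p ⁆ ] f ≡ f p
  ∑-⁅⁆ zero    f = trans (cong (f zero +_) (∑-⊥ (f ∘ suc))) (+-identityʳ _)
  ∑-⁅⁆ (suc p) f = trans (+-identityˡ _) (∑-⁅⁆ p (f ∘ suc))

  ∑-insertAt : ∀ {k} (S : Subset k) j s (f : Fin (ℕ.suc k) → Fin n) →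
               ∑[ insertAt S j s ] f ≡ (if s then f j else 0#) + ∑[ S ] (f ∘ punchIn j)
  ∑-insertAt S       zero    s f = refl
  ∑-insertAt (t ∷ S) (suc j) s f = begin
    fₜ + ∑[ insertAt S j s ] (f ∘ suc)         ≡⟨ cong (fₜ +_) (∑-insertAt S j s (f ∘ suc)) ⟩
    fₜ + (fₛ + ∑[ S ] (f ∘ suc ∘ punchIn j))   ≡⟨ x+[y+z]≡y+[x+z] fₜ fₛ _ ⟩
    fₛ + (fₜ + ∑[ S ] (f ∘ suc ∘ punchIn j))   ∎
    where
    open ≡-Reasoning
    fₜ fₛ : Fin n
    fₜ = if t then f zero else 0#
    fₛ = if s then f (suc j) else 0#

  ∈-insertAt : ∀ {k} (S : Subset k) j → j ∈ insertAt S j inside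
  ∈-insertAt S       zero    = here
  ∈-insertAt (_ ∷ S) (suc j) = there (∈-insertAt S j)

  punchIn-∈-insertAt : ∀ {k} {S : Subset k} j {s i} → i ∈ S → punchIn j i ∈ insertAt S j s
  punchIn-∈-insertAt zero    i∈S         = there i∈S
  punchIn-∈-insertAt (suc j) here        = here
  punchIn-∈-insertAt (suc j) (there i∈S) = there (punchIn-∈-insertAt j i∈S)

  ∈-insertAt-elim : ∀ {k} {P : Fin (ℕ.suc k) → Set} (S : Subset k) j {s} →
                    (s ≡ inside → P j) → (∀ i → i ∈ S → P (punchIn j i)) →
                    ∀ i → i ∈ insertAt S j s → P i
  ∈-insertAt-elim S       zero    Pj PS zero    here        = Pj refl
  ∈-insertAt-elim S       zero    Pj PS (suc i) (there i∈S) = PS i i∈S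
  ∈-insertAt-elim (_ ∷ S) (suc j) Pj PS zero    here        = PS zero here
  ∈-insertAt-elim (_ ∷ S) (suc j) Pj PS (suc i) (there i∈)  =
    ∈-insertAt-elim S j Pj (λ i i∈S → PS (suc i) (there i∈S)) i i∈

  initialSegment : ∀ {k} → Fin (ℕ.suc k) → Subset k
  initialSegment zero              = ⊥
  initialSegment {ℕ.suc k} (suc t) = inside ∷ initialSegment t

  prefix-collision : ∀ {k} (w : Fin k → Fin n) {i j : Fin (ℕ.suc k)} → i ≢ j →
                     ∑[ initialSegment i ] w ≡ ∑[ initialSegment j ] w →
                     ∃ λ S → Nonempty S × ∑[ S ] w ≡ 0#
  prefix-collision w {zero} {zero} i≢j _ = ⊥-elim (i≢j refl)
  prefix-collision {ℕ.suc k} w {zero} {suc j} _ eq =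
    inside ∷ initialSegment j , (zero , here) , trans (sym eq) (∑-⊥ w)
  prefix-collision {ℕ.suc k} w {suc i} {zero} i≢j eq = prefix-collision w (i≢j ∘ sym) (sym eq)
  prefix-collision {ℕ.suc k} w {suc i} {suc j} i≢j eq
    with prefix-collision (w ∘ suc) (i≢j ∘ cong suc) (+-cancelˡ (w zero) _ _ eq)
  ... | S , (p , p∈S) , ∑≡0 = outside ∷ S , (suc p , there p∈S) , trans (+-identityˡ _) ∑≡0

  zero-sum-subsequence : (w : Fin n → Fin n) → ∃ λ S → Nonempty S × ∑[ S ] w ≡ 0#
  zero-sum-subsequence w with pigeonhole (ℕ.n<1+n n) (λ t → ∑[ initialSegment t ] w)
  ... | i , j , i<j , eq = prefix-collision w (<⇒≢ i<j) eq

  -- Weighted zero-sum subsequences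

  HasSubseq : (∀ {k} → Seq n k → Subset k → Set) → ∀ {k} → Seq n k → Set
  HasSubseq P {k} x = Σ (Subset k) λ S → Nonempty S × P x S

  ABWeightedZS-intro : ∀ {A B : Pred (Fin n) 0ℓ} {k} {x : Seq n k} {S} →
                       (w : AWeightedZS n A x S) → AWeightedZS n B (proj₁ w) S → ABWeightedZS n A B x S
  ABWeightedZS-intro (a , a∈A , ∑ax≡0) (b , b∈B , ∑ba≡0) = a , b , a∈A , b∈B , ∑ax≡0 , ∑ba≡0

  AWeightedZS-cong : ∀ {A : Pred (Fin n) 0ℓ} {k} {x y : Seq n k} {S} →
                     x ≗ y → AWeightedZS n A x S → AWeightedZS n A y S
  AWeightedZS-cong {S = S} x≗y (a , a∈A , ∑ax≡0) =
    a , a∈A , trans (∑-cong S λ i _ → cong (a i *_) (sym (x≗y i))) ∑ax≡0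

  AWeightedZS-insertAt : ∀ {A : Pred (Fin n) 0ℓ} {k} {x : Seq n (ℕ.suc k)} j {S} →
                         AWeightedZS n A (Vector.removeAt x j) S → AWeightedZS n A x (insertAt S j outside)
  AWeightedZS-insertAt {A} {k} {x} j {S} (a , a∈A , ∑ax≡0) = a′ , ∈-insertAt-elim S j (λ ()) a′∈A , ∑a′x≡0
    where
    open ≡-Reasoning
    a′ : Fin (ℕ.suc k) → Fin n
    a′ = Vector.insertAt a j 0#
    a′∈A : ∀ i → i ∈ S → A (a′ (punchIn j i))
    a′∈A i i∈S = subst A (sym (insertAt-punchIn a j 0# i)) (a∈A i i∈S)
    ∑a′x≡0 : ∑[ insertAt S j outside ] (λ i → a′ i * x i) ≡ 0#
    ∑a′x≡0 = begin
      ∑[ insertAt S j outside ] (λ i → a′ i * x i)            ≡⟨ ∑-insertAt S j outside (λ i → a′ i * x i) ⟩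
      0# + ∑[ S ] (λ i → a′ (punchIn j i) * x (punchIn j i))  ≡⟨ +-identityˡ _ ⟩
      ∑[ S ] (λ i → a′ (punchIn j i) * x (punchIn j i))       ≡⟨ ∑-cong S (λ i _ → cong (_* _) (insertAt-punchIn a j 0# i)) ⟩
      ∑[ S ] (λ i → a i * x (punchIn j i))                    ≡⟨ ∑ax≡0 ⟩
      0#                                                      ∎

  HasSubseq-removeAt : ∀ {A B : Pred (Fin n) 0ℓ} {k} {x : Seq n (ℕ.suc k)} j →
                       HasSubseq (ABWeightedZS n A B) (Vector.removeAt x j) → HasSubseq (ABWeightedZS n A B) x
  HasSubseq-removeAt {A} {B} {x = x} j (S , (i , i∈S) , a , b , a∈A , b∈B , ∑ax≡0 , ∑ba≡0) =
    insertAt S j outside , (punchIn j i , punchIn-∈-insertAt j i∈S) ,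
    ABWeightedZS-intro {A} {B} {x = x} (AWeightedZS-insertAt {A} {x = x} j (a , a∈A , ∑ax≡0))
      (AWeightedZS-insertAt {B} {x = Vector.insertAt a j 0#} j
        (AWeightedZS-cong {B} (sym ∘ insertAt-punchIn a j 0#) (b , b∈B , ∑ba≡0)))

  pair-ABWeightedZS : 2 ≤ n → ∀ {A : Pred (Fin n) 0ℓ} {k} (x : Seq n (ℕ.suc k)) p q {a₀} → A a₀ →
                      a₀ * x p + a₀ * x (punchIn p q) ≡ 0# → HasSubseq (ABWeightedZS n A (NonZeroₙ n)) x
  pair-ABWeightedZS 2≤n {A} {k} x p q {a₀} A∋a₀ ∑≡0 =
    T , (p , ∈-insertAt ⁅ q ⁆ p) ,
    ABWeightedZS-intro {A} {NonZeroₙ n} {x = x}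
      ((λ _ → a₀) , (λ _ _ → A∋a₀) , trans (∑-pair (λ i → a₀ * x i)) ∑≡0)
      (b , b≢0 , trans (∑-pair (λ i → b i * a₀)) balanced)
    where
    open ≡-Reasoning
    T : Subset (ℕ.suc k)
    T = insertAt ⁅ q ⁆ p inside
    ∑-pair : ∀ f → ∑[ T ] f ≡ f p + f (punchIn p q)
    ∑-pair f = trans (∑-insertAt ⁅ q ⁆ p inside f) (cong (f p +_) (∑-⁅⁆ q (f ∘ punchIn p)))
    b : Fin (ℕ.suc k) → Fin n
    b = Vector.insertAt (λ _ → - 1#) p 1#
    b≢0 : ∀ i → i ∈ T → b i ≢ 0#
    b≢0 = ∈-insertAt-elim ⁅ q ⁆ p (λ _ → subst (_≢ 0#) (sym (insertAt-lookup _ p 1#)) (1≢0 2≤n))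
            (λ i _ → subst (_≢ 0#) (sym (insertAt-punchIn _ p 1# i)) (1≢0 2≤n ∘ -x≡0⇒x≡0))
    balanced : b p * a₀ + b (punchIn p q) * a₀ ≡ 0#
    balanced = begin
      b p * a₀ + b (punchIn p q) * a₀   ≡⟨ cong₂ (λ u v → u * a₀ + v * a₀) (insertAt-lookup _ p 1#) (insertAt-punchIn _ p 1# q) ⟩
      1# * a₀ + - 1# * a₀               ≡⟨ cong (1# * a₀ +_) (-‿distribˡ-* 1# a₀) ⟨
      1# * a₀ - 1# * a₀                 ≡⟨ -‿inverseʳ (1# * a₀) ⟩
      0#                                ∎

  NonzeroOn : ∀ {k} → Subset k → (Fin k → Fin n) → Set
  NonzeroOn S a = ∀ i → i ∈ S → a i ≢ 0#

  NonzeroOn-tail : ∀ {k s} {S : Subset k} {a : Fin (ℕ.suc k) → Fin n} →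
                   NonzeroOn (s ∷ S) a → NonzeroOn S (Vector.tail a)
  NonzeroOn-tail a≢0 i i∈S = a≢0 (suc i) (there i∈S)

  nonzero-sum-weighting : 2 < n → ∀ {k} (S : Subset k) (a : Fin k → Fin n) → Nonempty S → NonzeroOn S a →
                          ∃ λ b → NonzeroOn S b × ∑[ S ] (λ i → b i * a i) ≢ 0#
  nonzero-sum-weighting 2<n (outside ∷ S) a (suc i , there i∈S) a≢0
    with nonzero-sum-weighting 2<n S (Vector.tail a) (i , i∈S) (NonzeroOn-tail a≢0)
  ... | b , b≢0 , ∑≢0 =
    0# Vector.∷ b , (λ { (suc i) (there i∈S) → b≢0 i i∈S }) , ∑≢0 ∘ trans (sym (+-identityˡ _))
  nonzero-sum-weighting 2<n (inside ∷ S) a _ a≢0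
    with avoid-zero 2<n (∑[ S ] λ i → 1# * a (suc i)) (a≢0 zero here)
  ... | b₀ , b₀≢0 , ∑≢0 =
    b₀ Vector.∷ (λ _ → 1#) , (λ { zero _ → b₀≢0 ; (suc _) _ → 1≢0 (ℕ.<⇒≤ 2<n) }) , ∑≢0

  -- The head weight −v·u, with u the inverse of the head, cancels the non-zero total v of the tail.
  Z′-weighted-∷-unit : ∀ {k} {S : Subset k} {a : Fin (ℕ.suc k) → Fin n} → IsUnit n (a zero) →
                       (∃ λ b → NonzeroOn S b × ∑[ S ] (λ i → b i * a (suc i)) ≢ 0#) →
                       AWeightedZS n (NonZeroₙ n) a (inside ∷ S)
  Z′-weighted-∷-unit {S = S} {a} (u , a₀u≡1) (b , b≢0 , v≢0) =
    b₀ Vector.∷ b , (λ { zero _ b₀≡0 → v≢0 (v≡0 b₀≡0) ; (suc i) (there i∈S) → b≢0 i i∈S }) , total≡0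
    where
    open ≡-Reasoning
    a₀ v b₀ : Fin n
    a₀ = a zero
    v  = ∑[ S ] λ i → b i * a (suc i)
    b₀ = - v * u
    total≡0 : b₀ * a₀ + v ≡ 0#
    total≡0 = begin
      - v * u * a₀ + v     ≡⟨ cong (_+ v) (*-assoc (- v) u a₀) ⟩
      - v * (u * a₀) + v   ≡⟨ cong (λ w → - v * w + v) (trans (*-comm u a₀) a₀u≡1) ⟩
      - v * 1# + v         ≡⟨ cong (_+ v) (*-identityʳ (- v)) ⟩
      - v + v              ≡⟨ -‿inverseˡ v ⟩
      0#                   ∎
    v≡0 : b₀ ≡ 0# → v ≡ 0#
    v≡0 b₀≡0 = begin
      v             ≡⟨ +-identityˡ v ⟨
      0# + v        ≡⟨ cong (_+ v) (trans (cong (_* a₀) b₀≡0) (zeroˡ a₀)) ⟨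
      b₀ * a₀ + v   ≡⟨ total≡0 ⟩
      0#            ∎

  Z′-weighted-∷-nonunit : ∀ {k} {S : Subset k} {a : Fin (ℕ.suc k) → Fin n} → ¬ IsUnit n (a zero) →
                          AWeightedZS n (NonZeroₙ n) (Vector.tail a) S → AWeightedZS n (NonZeroₙ n) a (inside ∷ S)
  Z′-weighted-∷-nonunit ¬unit (b , b≢0 , ∑≡0) with zero-divisor ¬unit
  ... | c , c≢0 , ca₀≡0 =
    c Vector.∷ b , (λ { zero _ → c≢0 ; (suc i) (there i∈S) → b≢0 i i∈S }) ,
    trans (cong₂ _+_ ca₀≡0 ∑≡0) (+-identityˡ 0#)

  Z′-weighted-pair : ∀ {k} (q : Fin k) {a : Fin (ℕ.suc k) → Fin n} → a zero ≢ 0# → a (suc q) ≢ 0# →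
                     AWeightedZS n (NonZeroₙ n) a (inside ∷ ⁅ q ⁆)
  Z′-weighted-pair q {a} a₀≢0 a₁≢0 =
    a₁ Vector.∷ (λ _ → - a₀) , (λ { zero _ → a₁≢0 ; (suc _) _ → a₀≢0 ∘ -x≡0⇒x≡0 }) , (begin
      a₁ * a₀ + ∑[ ⁅ q ⁆ ] (λ i → - a₀ * a (suc i))   ≡⟨ cong (a₁ * a₀ +_) (∑-⁅⁆ q _) ⟩
      a₁ * a₀ + - a₀ * a₁                            ≡⟨ cong₂ _+_ (*-comm a₁ a₀) (sym (-‿distribˡ-* a₀ a₁)) ⟩
      a₀ * a₁ - a₀ * a₁                              ≡⟨ -‿inverseʳ (a₀ * a₁) ⟩
      0#                                             ∎)
    where
    open ≡-Reasoning
    a₀ a₁ : Fin n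
    a₀ = a zero
    a₁ = a (suc q)

  Z′-weighted-⁅⁆ : ∀ {k} (p : Fin k) {a : Fin k → Fin n} → ¬ IsUnit n (a p) →
                   AWeightedZS n (NonZeroₙ n) a ⁅ p ⁆
  Z′-weighted-⁅⁆ p ¬unit with zero-divisor ¬unit
  ... | c , c≢0 , cap≡0 = (λ _ → c) , (λ _ _ → c≢0) , trans (∑-⁅⁆ p _) cap≡0

  singleton⊎Z′-weighted : 2 < n → ∀ {k} (S : Subset k) (a : Fin k → Fin n) → Nonempty S → NonzeroOn S a →
                          (∃ λ p → S ≡ ⁅ p ⁆) ⊎ AWeightedZS n (NonZeroₙ n) a S
  singleton⊎Z′-weighted 2<n (outside ∷ S) a (suc i , there i∈S) a≢0
    with singleton⊎Z′-weighted 2<n S (Vector.tail a) (i , i∈S) (NonzeroOn-tail a≢0)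
  ... | inj₁ (p , S≡⁅p⁆)    = inj₁ (suc p , cong (outside ∷_) S≡⁅p⁆)
  ... | inj₂ (b , b≢0 , ∑≡0) =
    inj₂ (0# Vector.∷ b , (λ { (suc i) (there i∈S) → b≢0 i i∈S }) , trans (+-identityˡ _) ∑≡0)
  singleton⊎Z′-weighted 2<n (inside ∷ S) a _ a≢0 with nonempty? S
  ... | no  S≡∅ = inj₁ (zero , cong (inside ∷_) (Empty-unique S≡∅))
  ... | yes S≢∅ with singleton⊎Z′-weighted 2<n S (Vector.tail a) S≢∅ (NonzeroOn-tail a≢0) | IsUnit? (a zero)
  ...   | inj₁ (q , refl) | _     = inj₂ (Z′-weighted-pair q {a} (a≢0 zero here) (a≢0 (suc q) (there (x∈⁅x⁆ q))))
  ...   | inj₂ _          | yes u =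
    inj₂ (Z′-weighted-∷-unit {a = a} u (nonzero-sum-weighting 2<n S (Vector.tail a) S≢∅ (NonzeroOn-tail a≢0)))
  ...   | inj₂ w          | no ¬u = inj₂ (Z′-weighted-∷-nonunit {a = a} ¬u w)

  -- Existence of D_A(n)

  least-positive : ∀ {Q : ℕ → Set} → Decidable Q → ∀ m → 1 ≤ m → Q m → ∃ (IsLeastPos n Q)
  least-positive {Q} Q? = <-rec _ search
    where
    search : ∀ m → (∀ {k} → k < m → 1 ≤ k → Q k → ∃ (IsLeastPos n Q)) → 1 ≤ m → Q m → ∃ (IsLeastPos n Q)
    search m below 1≤m Qm with any? (λ (i : Fin m) → 1 ℕ.≤? toℕ i ×-dec Q? (toℕ i))
    ... | yes (i , 1≤i , Qi) = below (toℕ<n i) 1≤i Qi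
    ... | no  none           = m , 1≤m , Qm , λ k 1≤k Qk → ℕ.≮⇒≥ λ k<m →
      none (Fin.fromℕ< k<m , subst (λ j → 1 ≤ j × Q j) (sym (toℕ-fromℕ< k<m)) (1≤k , Qk))

  IsLeastPos-suc : ∀ {Q Q′ : ℕ → Set} {d} → IsLeastPos n Q d → ¬ Q 0 → (∀ k → Q′ (ℕ.suc k) → Q k) →
                   Q′ (ℕ.suc d) → IsLeastPos n Q′ (ℕ.suc d)
  IsLeastPos-suc {Q} (_ , _ , minimal) ¬Q0 down Q′d = s≤s z≤n , Q′d ,
    λ { (ℕ.suc k) _ Q′k → s≤s (minimal k (positive k (down k Q′k)) (down k Q′k)) }
    where
    positive : ∀ k → Q k → 1 ≤ k
    positive ℕ.zero    Q0 = ⊥-elim (¬Q0 Q0)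
    positive (ℕ.suc _) _  = s≤s z≤n

  IsLeastPos-⊆ : ∀ {Q Q′ : ℕ → Set} {d} → IsLeastPos n Q d → (∀ k → Q′ k → Q k) → Q′ d →
                 IsLeastPos n Q′ d
  IsLeastPos-⊆ (1≤d , _ , minimal) Q′⊆Q Q′d = 1≤d , Q′d , λ k 1≤k Q′k → minimal k 1≤k (Q′⊆Q k Q′k)

  ¬EveryHas-0 : ∀ {P : ∀ {k} → Seq n k → Subset k → Set} → ¬ EveryHas n P 0
  ¬EveryHas-0 every with every (λ ())
  ... | _ , (() , _) , _

  AWeightedZS? : (A : Subset n) → ∀ {k} (x : Seq n k) S → Dec (AWeightedZS n (_∈ A) x S)
  AWeightedZS? A x S =
    any-function? respects λ a → all? (λ i → i ∈? S →-dec a i ∈? A) ×-dec (∑[ S ] (λ i → a i * x i) ≟ 0#)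
    where
    respects : (λ a → (∀ i → i ∈ S → a i ∈ A) × ∑[ S ] (λ i → a i * x i) ≡ 0#) Respects _≗_
    respects a≗a′ (a∈A , ∑≡0) = (λ i i∈S → subst (_∈ A) (a≗a′ i) (a∈A i i∈S)) ,
                                trans (∑-cong S λ i _ → cong (_* x i) (sym (a≗a′ i))) ∑≡0

  EveryHas? : (A : Subset n) → Decidable (EveryHas n (AWeightedZS n (_∈ A)))
  EveryHas? A k = all-function? (λ x≗y (S , S≢∅ , w) → S , S≢∅ , AWeightedZS-cong {_∈ A} x≗y w)
                                λ x → anySubset? λ S → nonempty? S ×-dec AWeightedZS? A x S

  module _ (A : Subset n) where

    AZS ABZS : ∀ {k} → Seq n k → Subset k → Set
    AZS  = AWeightedZS n (_∈ A)
    ABZS = ABWeightedZS n (_∈ A) (NonZeroₙ n)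

    ABZS⇒AZS : ∀ k → EveryHas n ABZS k → EveryHas n AZS k
    ABZS⇒AZS _ every x with every x
    ... | S , S≢∅ , a , _ , a∈A , _ , ∑ax≡0 , _ = S , S≢∅ , a , a∈A , ∑ax≡0

    IsD_A-exists : ∀ {a₀} → a₀ ∈ A → 2 ≤ n → ∃ (IsD_A n (_∈ A))
    IsD_A-exists {a₀} a₀∈A 2≤n = least-positive (EveryHas? A) n (ℕ.≤-trans (s≤s z≤n) 2≤n) every
      where
      every : EveryHas n AZS n
      every x with zero-sum-subsequence (λ i → a₀ * x i)
      ... | S , S≢∅ , ∑≡0 = S , S≢∅ , (λ _ → a₀) , (λ _ _ → a₀∈A) , ∑≡0

    ∃-nonunit : ¬ (∀ c → c ∈ A → IsUnit n c) → ∃ λ c → c ∈ A × ¬ IsUnit n c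
    ∃-nonunit ¬units with any? (λ c → c ∈? A ×-dec ¬? (IsUnit? c))
    ... | yes found = found
    ... | no  none  = ⊥-elim (¬units λ c c∈A → decidable-stable (IsUnit? c) λ ¬unit → none (c , c∈A , ¬unit))

    module Units (units : ∀ c → c ∈ A → IsUnit n c) (2≤n : 2 ≤ n) where

      -- The lone term 0 has no (A, Z′ₙ)-weighted zero sum: b·u = 0 forces b = 0 for a unit u.
      drop-zero-head : ∀ {k} {y : Seq n k} → HasSubseq ABZS (0# Vector.∷ y) → HasSubseq AZS y
      drop-zero-head (outside ∷ S , (suc i , there i∈S) , a , _ , a∈A , _ , ∑ax≡0 , _) =
        S , (i , i∈S) , Vector.tail a , (λ i → a∈A (suc i) ∘ there) , trans (sym (+-identityˡ _)) ∑ax≡0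
      drop-zero-head {y = y} (inside ∷ S , _ , a , b , a∈A , b≢0 , ∑ax≡0 , ∑ba≡0) with nonempty? S
      ... | yes S≢∅ = S , S≢∅ , Vector.tail a , (λ i → a∈A (suc i) ∘ there) , trans (sym head≡0) ∑ax≡0
        where
        head≡0 : a zero * 0# + ∑[ S ] (λ i → a (suc i) * y i) ≡ ∑[ S ] (λ i → a (suc i) * y i)
        head≡0 = trans (cong (_+ ∑[ S ] (λ i → a (suc i) * y i)) (zeroʳ (a zero))) (+-identityˡ _)
      ... | no  S≡∅ = ⊥-elim (b≢0 zero here (unit*y≡0⇒y≡0 {a zero} (units _ (a∈A zero here)) a₀b₀≡0))
        where
        open ≡-Reasoning
        rest : Fin _ → Fin n
        rest i = b (suc i) * a (suc i)
        a₀b₀≡0 : a zero * b zero ≡ 0#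
        a₀b₀≡0 = begin
          a zero * b zero                 ≡⟨ *-comm (a zero) (b zero) ⟩
          b zero * a zero                 ≡⟨ +-identityʳ _ ⟨
          b zero * a zero + 0#            ≡⟨ cong (b zero * a zero +_) (∑-⊥ rest) ⟨
          b zero * a zero + ∑[ ⊥ ] rest   ≡⟨ cong (λ T → b zero * a zero + ∑[ T ] rest) (Empty-unique S≡∅) ⟨
          b zero * a zero + ∑[ S ] rest   ≡⟨ ∑ba≡0 ⟩
          0#                              ∎

      ABZS-suc⇒AZS : ∀ k → EveryHas n ABZS (ℕ.suc k) → EveryHas n AZS k
      ABZS-suc⇒AZS k every y = drop-zero-head (every (0# Vector.∷ y))

      AZS⇒2≤ : ∀ {d} → EveryHas n AZS d → 2 ≤ d
      AZS⇒2≤ {ℕ.zero} every = ⊥-elim (¬EveryHas-0 {AZS} every)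
      AZS⇒2≤ {1} every with every (λ _ → 1#)
      ... | inside ∷ [] , _ , a , a∈A , ∑≡0 =
            ⊥-elim (1≢0 2≤n (unit*y≡0⇒y≡0 {a zero} (units _ (a∈A zero here)) (trans (sym (+-identityʳ _)) ∑≡0)))
      ... | outside ∷ [] , (zero , ()) , _
      AZS⇒2≤ {ℕ.suc (ℕ.suc _)} _ = s≤s (s≤s z≤n)

      removeAt⇒ABZS⊎zero : 2 < n → ∀ {d} → EveryHas n AZS d → (x : Seq n (ℕ.suc d)) (j : Fin (ℕ.suc d)) →
                           HasSubseq ABZS x ⊎ ∃ λ q → x (punchIn j q) ≡ 0#
      removeAt⇒ABZS⊎zero 2<n every x j with every (Vector.removeAt x j)
      ... | S , S≢∅ , w@(a , a∈A , ∑ax≡0)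
          with singleton⊎Z′-weighted 2<n S a S≢∅ (λ i i∈S → unit≢0 2≤n {a i} (units _ (a∈A i i∈S)))
      ...   | inj₂ z          = inj₁ (HasSubseq-removeAt {_∈ A} {NonZeroₙ n} {x = x} j
                                        (S , S≢∅ , ABWeightedZS-intro {_∈ A} {NonZeroₙ n} {x = Vector.removeAt x j} w z))
      ...   | inj₁ (q , refl) =
              inj₂ (q , unit*y≡0⇒y≡0 {a q} (units _ (a∈A q (x∈⁅x⁆ q))) (trans (sym (∑-⁅⁆ q _)) ∑ax≡0))

      AZS⇒ABZS-suc : ∀ {a₀} → a₀ ∈ A → ∀ {d} → EveryHas n AZS d → EveryHas n ABZS (ℕ.suc d)
      AZS⇒ABZS-suc {a₀} a₀∈A every x with n ℕ.≤? 2
      ... | no n≰2 with removeAt⇒ABZS⊎zero (ℕ.≰⇒> n≰2) every x zero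
      ...   | inj₁ found      = found
      ...   | inj₂ (p , xp≡0) with removeAt⇒ABZS⊎zero (ℕ.≰⇒> n≰2) every x (suc p)
      ...     | inj₁ found      = found
      ...     | inj₂ (q , xq≡0) = pair-ABWeightedZS 2≤n {_∈ A} x (suc p) q a₀∈A (begin
        a₀ * x (suc p) + a₀ * x (punchIn (suc p) q)   ≡⟨ cong₂ (λ u v → a₀ * u + a₀ * v) xp≡0 xq≡0 ⟩
        a₀ * 0# + a₀ * 0#                              ≡⟨ cong₂ _+_ (zeroʳ a₀) (zeroʳ a₀) ⟩
        0# + 0#                                        ≡⟨ +-identityˡ 0# ⟩
        0#                                             ∎)
        where open ≡-Reasoning
      AZS⇒ABZS-suc {a₀} a₀∈A every x | yes n≤2 with pigeonhole (s≤s (ℕ.≤-trans n≤2 (AZS⇒2≤ every))) x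
      ... | i , j , i<j , xi≡xj = pair-ABWeightedZS 2≤n {_∈ A} x i (punchOut (<⇒≢ i<j)) a₀∈A (begin
        a₀ * x i + a₀ * x (punchIn i (punchOut (<⇒≢ i<j)))  ≡⟨ cong (λ k → a₀ * x i + a₀ * x k) (punchIn-punchOut (<⇒≢ i<j)) ⟩
        a₀ * x i + a₀ * x j                                 ≡⟨ cong (λ y → a₀ * x i + a₀ * y) xi≡xj ⟨
        a₀ * x i + a₀ * x i                                 ≡⟨ y+y≡0 2≤n n≤2 (a₀ * x i) ⟩
        0#                                                  ∎)
        where open ≡-Reasoning

      IsD_AB-suc : ∀ {a₀} → a₀ ∈ A → ∀ {d} → IsD_A n (_∈ A) d → IsD_AB n (_∈ A) (NonZeroₙ n) (ℕ.suc d)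
      IsD_AB-suc a₀∈A D@(_ , every , _) = IsLeastPos-suc D (¬EveryHas-0 {AZS}) ABZS-suc⇒AZS (AZS⇒ABZS-suc a₀∈A every)

    module NonUnit (nonzero : ∀ c → c ∈ A → c ≢ 0#) {c} (c∈A : c ∈ A) (¬unit : ¬ IsUnit n c) where

      AZS⇒ABZS : ∀ {d} → EveryHas n AZS d → EveryHas n ABZS d
      AZS⇒ABZS every x with every x
      ... | S , S≢∅ , w@(a , a∈A , ∑ax≡0)
          with singleton⊎Z′-weighted (≢0∧¬unit⇒2<n (nonzero c c∈A) ¬unit) S a S≢∅
                 (λ i i∈S → nonzero (a i) (a∈A i i∈S))
      ...   | inj₂ z          = S , S≢∅ , ABWeightedZS-intro {_∈ A} {NonZeroₙ n} {x = x} w z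
      ...   | inj₁ (p , refl) with IsUnit? (a p)
      ...     | no ¬unitₚ = ⁅ p ⁆ , S≢∅ , ABWeightedZS-intro {_∈ A} {NonZeroₙ n} {x = x} w
                              (Z′-weighted-⁅⁆ p {a} ¬unitₚ)
      ...     | yes unitₚ = ⁅ p ⁆ , S≢∅ , ABWeightedZS-intro {_∈ A} {NonZeroₙ n} {x = x}
                              ((λ _ → c) , (λ _ _ → c∈A) , trans (∑-⁅⁆ p _) (trans (cong (c *_) xₚ≡0) (zeroʳ c)))
                              (Z′-weighted-⁅⁆ p {λ _ → c} ¬unit)
        where
        xₚ≡0 : x p ≡ 0#
        xₚ≡0 = unit*y≡0⇒y≡0 {a p} unitₚ (trans (sym (∑-⁅⁆ p _)) ∑ax≡0)

      IsD_AB-same : ∀ {d} → IsD_A n (_∈ A) d → IsD_AB n (_∈ A) (NonZeroₙ n) d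
      IsD_AB-same D@(_ , every , _) = IsLeastPos-⊆ D ABZS⇒AZS (AZS⇒ABZS every)

theorem14 : (n : ℕ) .{{_ : NonZero n}} → 2 ≤ n → (A : Subset n) → Nonempty A →
    ((∀ a → a ∈ A → IsUnit n a) →
      Σ ℕ λ d → IsD_A n (_∈ A) d × IsD_AB n (_∈ A) (NonZeroₙ n) (d ℕ.+ 1))
    × ((∀ a → a ∈ A → NonZeroₙ n a) → ¬ (∀ a → a ∈ A → IsUnit n a) →
      Σ ℕ λ d → IsD_A n (_∈ A) d × IsD_AB n (_∈ A) (NonZeroₙ n) d)
theorem14 n 2≤n A (a₀ , a₀∈A) with IsD_A-exists n A a₀∈A 2≤n
... | d , D =
  (λ units → d , D , subst (IsD_AB n (_∈ A) (NonZeroₙ n)) (ℕ.+-comm 1 d) (Units.IsD_AB-suc n A units 2≤n a₀∈A D)) ,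
  (λ nonzero ¬units → let c , c∈A , ¬unit = ∃-nonunit n A ¬units in
                      d , D , NonUnit.IsD_AB-same n A nonzero c∈A ¬unit D)
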